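{- Let $(X,\vartriangleleft)$ be a relational frame. In each of the following pairs, (a) and (b) are equivalent: (1)(a) for all $c_\vartriangleleft$-fixpoints $A$, $A\cap\neg_\vartriangleleft A=0$; (b) for every non-absurd $x\in X$ there is $z\vartriangleleft x$ that pre-refines $x$. (2)(a) for all $c_\vartriangleleft$-fixpoints $A$, $A\subseteq\neg_\vartriangleleft\neg_\vartriangleleft A$; (b) (pseudosymmetry) for all $x\in X$ and $y\vartriangleleft x$, there is $z\vartriangleleft y$ that pre-refines $x$. (3)(a) for all $c_\vartriangleleft$-fixpoints $A,B$, if $A\cap B=0$ then $A\subseteq\neg_\vartriangleleft B$; (b) (weak compossibility) for all $x\in X$ and $y\vartriangleleft x$, there is a non-absurd $z$ that pre-refines both $y$ and $x$. (4)(a) for all $c_\vartriangleleft$-fixpoints $A$, $\neg_\vartriangleleft\neg_\vartriangleleft A\subseteq A$; (b) for all $x\in X$ and $y\vartriangleleft x$, there is $y'\vartriangleleft x$ such that for all $z\in X$, if $z\vartriangleleft y'$ then $y\vartriangleleft z$.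
   Context: A relational frame is a pair $(X,\vartriangleleft)$ with $X$ nonempty and $\vartriangleleft$ a binary relation on $X$; write $y\vartriangleright x$ for $x\vartriangleleft y$. $c_\vartriangleleft(A)=\{x\in X\mid\forall x'\vartriangleleft x\ \exists x''\vartriangleright x':\ x''\in A\}$; $A$ is a $c_\vartriangleleft$-fixpoint if $c_\vartriangleleft(A)=A$. $\neg_\vartriangleleft A=\{x\in X\mid\forall y\vartriangleleft x,\ y\notin A\}$. $0$ denotes the least $c_\vartriangleleft$-fixpoint, namely $c_\vartriangleleft(\varnothing)$, which equals the set of absurd states. A state $x$ is absurd if there is no $y$ with $y\vartriangleleft x$. A state $x$ pre-refines $y$ if for all $z\in X$, $z\vartriangleleft x$ implies $z\vartriangleleft y$. -}

module Defs where

open import Level using (0ℓ)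
open import Data.Product using (Σ; ∃; _×_; _,_)
open import Relation.Nullary using (¬_)
open import Relation.Unary using (Pred; _⊆_; _∩_; _≐_; ∅)

-- A relational frame: a carrier X (nonemptiness is supplied separately)
-- and a relation  _◁_ : X → X → Set ;  "x ◁ y" is written  R x y.
Rel : Set → Set₁
Rel X = X → X → Set

Subset : Set → Set₁
Subset X = Pred X 0ℓ

module Frame {X : Set} (R : Rel X) where

  c : Subset X → Subset X
  c A x = ∀ x' → R x' x → Σ X λ x'' → R x' x'' × A x''

  IsFixpoint : Subset X → Set
  IsFixpoint A = c A ≐ A

  neg : Subset X → Subset X
  neg A x = ∀ y → R y x → ¬ A y

  -- 0 = c_◁(∅), the least fixpoint
  zero : Subset X
  zero = c ∅

  Absurd : X → Set
  Absurd x = ∀ y → ¬ R y x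

  PreRefines : X → X → Set
  PreRefines x y = ∀ z → R z x → R z y

{-# OPTIONS --safe #-}
-- Every c-fixpoint A is closed under pre-refinement, and for each x the set
-- ↓x of pre-refinements of x is the least c-fixpoint containing x.  Hence a
-- condition on fixpoints of the form "A x ⇒ …" holds as soon as it holds for
-- the principal fixpoints ↓x, and on ↓x it unfolds to the first-order frame
-- condition.  For (4) the test set is instead c {w | ¬ y ◁ w}, the least
-- fixpoint omitting every successor of y.  Only the directions from fixpoints
-- to frame conditions use excluded middle.
module Submission where

open import Defs
open import Data.Product using (Σ; _×_; _,_)
open import Data.Sum using (_⊎_; inj₁; inj₂)
open import Data.Empty using (⊥-elim)
open import Relation.Nullary using (¬_)
open import Relation.Unary using (_⊆_; _∩_; _≐_)
open import Function.Bundles using (_⇔_; mk⇔)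

module FrameTheory {X : Set} (R : Rel X) where
  open Frame R

  Noncontradiction : Set₁
  Noncontradiction = ∀ A → IsFixpoint A → (A ∩ neg A) ≐ zero

  NonAbsurdSelfRefining : Set
  NonAbsurdSelfRefining = ∀ x → ¬ Absurd x → Σ X λ z → R z x × PreRefines z x

  DoubleNegationIntro : Set₁
  DoubleNegationIntro = ∀ A → IsFixpoint A → A ⊆ neg (neg A)

  Pseudosymmetric : Set
  Pseudosymmetric = ∀ x y → R y x → Σ X λ z → R z y × PreRefines z x

  DisjointNegates : Set₁
  DisjointNegates = ∀ A B → IsFixpoint A → IsFixpoint B → (A ∩ B) ≐ zero → A ⊆ neg B

  WeaklyCompossible : Set
  WeaklyCompossible = ∀ x y → R y x → Σ X λ z → ¬ Absurd z × PreRefines z y × PreRefines z x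

  DoubleNegationElim : Set₁
  DoubleNegationElim = ∀ A → IsFixpoint A → neg (neg A) ⊆ A

  ConverseAccessible : Set
  ConverseAccessible = ∀ x y → R y x → Σ X λ y′ → R y′ x × (∀ z → R z y′ → R y z)

  c-inflationary : ∀ A → A ⊆ c A
  c-inflationary A {x} ax x′ x′◁x = x , x′◁x , ax

  c-isFixpoint : ∀ A → IsFixpoint (c A)
  c-isFixpoint A = c∘c⊆c , c-inflationary (c A)
    where
    c∘c⊆c : c (c A) ⊆ c A
    c∘c⊆c h x′ x′◁x with h x′ x′◁x
    ... | x″ , x′◁x″ , cAx″ = cAx″ x′ x′◁x″

  ↓ : X → Subset X
  ↓ x z = PreRefines z x

  ↓-refl : ∀ x → ↓ x x
  ↓-refl x z z◁x = z◁x

  ↓-isFixpoint : ∀ x → IsFixpoint (↓ x)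
  ↓-isFixpoint x = c↓⊆↓ , c-inflationary (↓ x)
    where
    c↓⊆↓ : c (↓ x) ⊆ ↓ x
    c↓⊆↓ h z z◁w with h z z◁w
    ... | x″ , z◁x″ , x″⊑x = x″⊑x z z◁x″

  fixpoint-preRefinement-closed : ∀ {A x z} → IsFixpoint A → A x → PreRefines z x → A z
  fixpoint-preRefinement-closed {x = x} (cA⊆A , _) ax z⊑x = cA⊆A λ w w◁z → x , z⊑x w w◁z , ax

  zero⇒Absurd : ∀ {x} → zero x → Absurd x
  zero⇒Absurd h y y◁x with h y y◁x
  ... | _ , _ , ()

  Absurd⇒zero : ∀ {x} → Absurd x → zero x
  Absurd⇒zero a y y◁x = ⊥-elim (a y y◁x)

  zero⊆fixpoint : ∀ {A} → IsFixpoint A → zero ⊆ A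
  zero⊆fixpoint (cA⊆A , _) zx = cA⊆A λ w w◁x → ⊥-elim (zero⇒Absurd zx w w◁x)

  zero⊆neg : ∀ A → zero ⊆ neg A
  zero⊆neg A zx y y◁x _ = zero⇒Absurd zx y y◁x

  fixpoints-∩≐zero : ∀ {A B} → IsFixpoint A → IsFixpoint B → A ∩ B ⊆ zero → (A ∩ B) ≐ zero
  fixpoints-∩≐zero fA fB A∩B⊆zero = A∩B⊆zero , λ zx → zero⊆fixpoint fA zx , zero⊆fixpoint fB zx

  NonAbsurdSelfRefining⇒Noncontradiction : NonAbsurdSelfRefining → Noncontradiction
  NonAbsurdSelfRefining⇒Noncontradiction h A fA = A∩negA⊆zero , λ zx → zero⊆fixpoint fA zx , zero⊆neg A zx
    where
    A∩negA⊆zero : A ∩ neg A ⊆ zero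
    A∩negA⊆zero {x} (ax , negAx) = Absurd⇒zero λ y y◁x →
      let z , z◁x , z⊑x = h x (λ a → a y y◁x)
      in negAx z z◁x (fixpoint-preRefinement-closed fA ax z⊑x)

  Pseudosymmetric⇒DoubleNegationIntro : Pseudosymmetric → DoubleNegationIntro
  Pseudosymmetric⇒DoubleNegationIntro h A fA {x} ax y y◁x negAy =
    let z , z◁y , z⊑x = h x y y◁x
    in negAy z z◁y (fixpoint-preRefinement-closed fA ax z⊑x)

  WeaklyCompossible⇒DisjointNegates : WeaklyCompossible → DisjointNegates
  WeaklyCompossible⇒DisjointNegates h A B fA fB (A∩B⊆zero , _) {x} ax y y◁x By =
    let z , z-nonAbsurd , z⊑y , z⊑x = h x y y◁x
    in z-nonAbsurd (zero⇒Absurd (A∩B⊆zero ( fixpoint-preRefinement-closed fA ax z⊑x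
                                          , fixpoint-preRefinement-closed fB By z⊑y)))

module Correspondence (lem : (P : Set) → P ⊎ ¬ P) {X : Set} (R : Rel X) where
  open Frame R
  open FrameTheory R

  byContradiction : {P : Set} → ¬ ¬ P → P
  byContradiction {P} ¬¬p with lem P
  ... | inj₁ p  = p
  ... | inj₂ ¬p = ⊥-elim (¬¬p ¬p)

  Noncontradiction⇒NonAbsurdSelfRefining : Noncontradiction → NonAbsurdSelfRefining
  Noncontradiction⇒NonAbsurdSelfRefining h x x-nonAbsurd = byContradiction λ ¬refined →
    let x∈neg↓x : neg (↓ x) x
        x∈neg↓x z z◁x z⊑x = ¬refined (z , z◁x , z⊑x)
        (↓x∩neg↓x⊆zero , _) = h (↓ x) (↓-isFixpoint x)
    in x-nonAbsurd (zero⇒Absurd (↓x∩neg↓x⊆zero (↓-refl x , x∈neg↓x)))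

  DoubleNegationIntro⇒Pseudosymmetric : DoubleNegationIntro → Pseudosymmetric
  DoubleNegationIntro⇒Pseudosymmetric h x y y◁x = byContradiction λ ¬refined →
    h (↓ x) (↓-isFixpoint x) (↓-refl x) y y◁x λ z z◁y z⊑x → ¬refined (z , z◁y , z⊑x)

  DisjointNegates⇒WeaklyCompossible : DisjointNegates → WeaklyCompossible
  DisjointNegates⇒WeaklyCompossible h x y y◁x = byContradiction λ ¬compossible →
    let common⇒absurd : ↓ x ∩ ↓ y ⊆ zero
        common⇒absurd {z} (z⊑x , z⊑y) =
          Absurd⇒zero (byContradiction λ z-nonAbsurd → ¬compossible (z , z-nonAbsurd , z⊑y , z⊑x))
        disjoint = fixpoints-∩≐zero (↓-isFixpoint x) (↓-isFixpoint y) common⇒absurd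
    in h (↓ x) (↓ y) (↓-isFixpoint x) (↓-isFixpoint y) disjoint (↓-refl x) y y◁x (↓-refl y)

  DoubleNegationElim⇒ConverseAccessible : DoubleNegationElim → ConverseAccessible
  DoubleNegationElim⇒ConverseAccessible h x y y◁x = byContradiction λ ¬accessible →
    x∉A (h A (c-isFixpoint NonSuccessors) λ y′ y′◁x negAy′ →
      ¬accessible (y′ , y′◁x , λ z z◁y′ → byContradiction λ ¬y◁z →
        negAy′ z z◁y′ (c-inflationary NonSuccessors ¬y◁z)))
    where
    NonSuccessors : Subset X
    NonSuccessors w = ¬ R y w
    A : Subset X
    A = c NonSuccessors
    x∉A : ¬ A x
    x∉A cx with cx y y◁x
    ... | _ , y◁x″ , ¬y◁x″ = ¬y◁x″ y◁x″

  ConverseAccessible⇒DoubleNegationElim : ConverseAccessible → DoubleNegationElim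
  ConverseAccessible⇒DoubleNegationElim h A (cA⊆A , _) {x} ¬¬Ax = cA⊆A λ y y◁x →
    byContradiction λ ¬reachesA →
      let y′ , y′◁x , below⇒succ = h x y y◁x
      in ¬¬Ax y′ y′◁x λ z z◁y′ Az → ¬reachesA (z , below⇒succ z z◁y′ , Az)

proposition4p14 : (lem : (P : Set) → P ⊎ ¬ P) →
  (X : Set) → (x₀ : X) → (R : Rel X) →
  let open Frame R in
  ((∀ A → IsFixpoint A → (A ∩ neg A) ≐ zero)
    ⇔ (∀ x → ¬ Absurd x → Σ X λ z → R z x × PreRefines z x))
  × ((∀ A → IsFixpoint A → A ⊆ neg (neg A))
    ⇔ (∀ x y → R y x → Σ X λ z → R z y × PreRefines z x))
  × ((∀ A B → IsFixpoint A → IsFixpoint B → (A ∩ B) ≐ zero → A ⊆ neg B)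
    ⇔ (∀ x y → R y x → Σ X λ z → ¬ Absurd z × PreRefines z y × PreRefines z x))
  × ((∀ A → IsFixpoint A → neg (neg A) ⊆ A)
    ⇔ (∀ x y → R y x → Σ X λ y′ → R y′ x × (∀ z → R z y′ → R y z)))
proposition4p14 lem X _ R =
    mk⇔ Noncontradiction⇒NonAbsurdSelfRefining NonAbsurdSelfRefining⇒Noncontradiction
  , mk⇔ DoubleNegationIntro⇒Pseudosymmetric Pseudosymmetric⇒DoubleNegationIntro
  , mk⇔ DisjointNegates⇒WeaklyCompossible WeaklyCompossible⇒DisjointNegates
  , mk⇔ DoubleNegationElim⇒ConverseAccessible ConverseAccessible⇒DoubleNegationElim
  where
  open FrameTheory R
  open Correspondence lem R
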